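{- Let $n$ be a positive integer and $c,c'$ colours from $\{a_ib_k:0\le i,k\le n-1\}$. Then $\Delta(c,c')=0$ if and only if one of the following holds: (1) $c=c'$ and $c$ is free; (2) $c=a_ib_j$ is bound, $c'=a_kb_k$ is free, and $i<k\le j$; (3) $c=a_kb_k$ is free, $c'=a_ib_j$ is bound, and $j<k\le i$; (4) $c=a_ib_j$ and $c'=a_kb_\ell$ are both bound, $i<k$ and $j>\ell$.
   Context: $\chi(P)$ is $1$ if the proposition $P$ is true and $0$ otherwise, and $\Delta(a_ib_k,a_{i'}b_{k'})=\chi(i\ge i')-\chi(i=k=i')+\chi(k\le k')-\chi(k=i'=k')$. A colour $a_ib_i$ is called free and $a_ib_k$ with $i\ne k$ bound. -}

module Defs where

open import Data.Nat using (ℕ)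
open import Data.Fin using (Fin; toℕ)
open import Data.Product using (_×_; _,_)
open import Data.Integer using (ℤ; +_; _+_; _-_)
open import Relation.Nullary using (Dec; yes; no; ¬_)
open import Relation.Nullary.Decidable using (⌊_⌋)
open import Data.Bool using (Bool; true; false)
open import Relation.Binary.PropositionalEquality using (_≡_)
import Data.Nat as ℕ
import Data.Fin as F
open import Data.Product using (Σ)

-- A colour a_i b_k with 0 ≤ i,k ≤ n-1 is the pair (i , k).
Colour : ℕ → Set
Colour n = Fin n × Fin n

χ : ∀ {p} {P : Set p} → Dec P → ℤ
χ (yes _) = + 1
χ (no _)  = + 0

Δ : ∀ {n} → Colour n → Colour n → ℤ
Δ (i , k) (i' , k') =
  ((χ (toℕ i' ℕ.≤? toℕ i) - χ (both (i F.≟ k) (k F.≟ i')))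
   + χ (toℕ k ℕ.≤? toℕ k'))
   - χ (both (k F.≟ i') (i' F.≟ k'))
  where
  open import Relation.Nullary.Decidable using (_×-dec_)
  both : ∀ {A B : Set} → Dec A → Dec B → Dec (A × B)
  both = _×-dec_

Free : ∀ {n} → Colour n → Set
Free (i , k) = i ≡ k

Bound : ∀ {n} → Colour n → Set
Bound (i , k) = ¬ (i ≡ k)

-- Δ splits as [χ(i ≥ i') − χ(i = k = i')] + [χ(k ≤ k') − χ(k = i' = k')], and the
-- subtracted condition in each bracket implies the added one, so both brackets are
-- 0 or 1. Hence Δ = 0 exactly when i' ≤ i forces i = k = i' and k ≤ k' forces
-- k = i' = k'; splitting on the two comparisons yields the four listed cases.
module Submission where

open import Defs
open import Data.Nat using (ℕ; NonZero; z≤n)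
open import Data.Fin using (_<_; _≤_; _>_)
open import Data.Product using (_×_; _,_; ∃-syntax)
open import Data.Sum using (_⊎_; inj₁; inj₂)
open import Data.Integer using (ℤ; +_; 0ℤ; _+_; _-_; -_; +≤+)
  renaming (_≤_ to _≤ℤ_)
open import Relation.Binary.PropositionalEquality using (_≡_; refl; sym; cong; cong₂; subst)
open import Function.Base using (_∘_)
open import Function.Bundles using (_⇔_; mk⇔; Equivalence)
open import Function.Construct.Composition using (_⇔-∘_)
open import Relation.Nullary using (Dec; yes; no; contradiction)
open import Relation.Nullary.Decidable using (_×-dec_)
import Data.Nat.Properties as ℕ
import Data.Integer.Properties as ℤ
import Data.Fin.Properties as F

+-nonneg-≡0 : {x y : ℤ} → 0ℤ ≤ℤ x → 0ℤ ≤ℤ y → x + y ≡ 0ℤ → x ≡ 0ℤ × y ≡ 0ℤ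
+-nonneg-≡0 {+ m} (+≤+ _) (+≤+ _) m+n≡0 =
  cong +_ (ℕ.m+n≡0⇒m≡0 m (ℤ.+-injective m+n≡0)) , cong +_ (ℕ.m+n≡0⇒n≡0 m (ℤ.+-injective m+n≡0))

χ-sub-χ-nonneg : {A B : Set} (a : Dec A) (b : Dec B) → (B → A) → 0ℤ ≤ℤ χ a - χ b
χ-sub-χ-nonneg (yes _) (yes _) _   = +≤+ z≤n
χ-sub-χ-nonneg (yes _) (no _)  _   = +≤+ z≤n
χ-sub-χ-nonneg (no ¬A) (yes B) B⇒A = contradiction (B⇒A B) ¬A
χ-sub-χ-nonneg (no _)  (no _)  _   = +≤+ z≤n

χ-sub-χ≡0⇔ : {A B : Set} (a : Dec A) (b : Dec B) → (B → A) → (χ a - χ b ≡ 0ℤ) ⇔ (A → B)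
χ-sub-χ≡0⇔ {A} {B} a b B⇒A = mk⇔ (to a b) (from a b)
  where
  to : (a : Dec A) (b : Dec B) → χ a - χ b ≡ 0ℤ → A → B
  to _       (yes B) _  _ = B
  to (yes _) (no _)  () _
  to (no ¬A) (no _)  _  A = contradiction A ¬A

  from : (a : Dec A) (b : Dec B) → (A → B) → χ a - χ b ≡ 0ℤ
  from (yes _) (yes _) _   = refl
  from (yes A) (no ¬B) A⇒B = contradiction (A⇒B A) ¬B
  from (no ¬A) (yes B) _   = contradiction (B⇒A B) ¬A
  from (no _)  (no _)  _   = refl

χ-brackets≡0⇔ : {A B C D : Set} (a : Dec A) (b : Dec B) (c : Dec C) (d : Dec D) →
  (B → A) → (D → C) →
  ((χ a - χ b) + (χ c - χ d) ≡ 0ℤ) ⇔ ((A → B) × (C → D))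
χ-brackets≡0⇔ {A} {B} {C} {D} a b c d B⇒A D⇒C = mk⇔ to from
  where
  module Left  = Equivalence (χ-sub-χ≡0⇔ a b B⇒A)
  module Right = Equivalence (χ-sub-χ≡0⇔ c d D⇒C)

  to : (χ a - χ b) + (χ c - χ d) ≡ 0ℤ → (A → B) × (C → D)
  to eq with +-nonneg-≡0 (χ-sub-χ-nonneg a b B⇒A) (χ-sub-χ-nonneg c d D⇒C) eq
  ... | left≡0 , right≡0 = Left.to left≡0 , Right.to right≡0

  from : (A → B) × (C → D) → (χ a - χ b) + (χ c - χ d) ≡ 0ℤ
  from (A⇒B , C⇒D) = cong₂ _+_ (Left.from A⇒B) (Right.from C⇒D)

module _ {n : ℕ} where

  Δ-Vanishes : Colour n → Colour n → Set
  Δ-Vanishes (i , k) (i' , k') = (i' ≤ i → i ≡ k × k ≡ i') × (k ≤ k' → k ≡ i' × i' ≡ k')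

  Δ≡0⇔Δ-Vanishes : (c c' : Colour n) → (Δ c c' ≡ 0ℤ) ⇔ Δ-Vanishes c c'
  Δ≡0⇔Δ-Vanishes (i , k) (i' , k') =
    subst (λ x → (x ≡ 0ℤ) ⇔ Δ-Vanishes (i , k) (i' , k'))
      (sym (ℤ.+-assoc (χ i'≤i - χ i=k=i') (χ k≤k') (- χ k=i'=k')))
      (χ-brackets≡0⇔ i'≤i i=k=i' k≤k' k=i'=k'
        (λ { (refl , refl) → F.≤-refl }) (λ { (refl , refl) → F.≤-refl }))
    where
    i'≤i : Dec (i' ≤ i)
    i'≤i = i' F.≤? i
    i=k=i' : Dec (i ≡ k × k ≡ i')
    i=k=i' = (i F.≟ k) ×-dec (k F.≟ i')
    k≤k' : Dec (k ≤ k')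
    k≤k' = k F.≤? k'
    k=i'=k' : Dec (k ≡ i' × i' ≡ k')
    k=i'=k' = (k F.≟ i') ×-dec (i' F.≟ k')

  Classification : Colour n → Colour n → Set
  Classification c c' =
    (c ≡ c' × Free c)
    ⊎ (∃[ i ] ∃[ j ] ∃[ k ] (c ≡ (i , j) × Bound c × c' ≡ (k , k) × i < k × k ≤ j))
    ⊎ (∃[ i ] ∃[ j ] ∃[ k ] (c ≡ (k , k) × c' ≡ (i , j) × Bound c' × j < k × k ≤ i))
    ⊎ (∃[ i ] ∃[ j ] ∃[ k ] ∃[ l ] (c ≡ (i , j) × c' ≡ (k , l) × Bound c × Bound c' × i < k × j > l))

  Δ-Vanishes⇒Classification : (c c' : Colour n) → Δ-Vanishes c c' → Classification c c'
  Δ-Vanishes⇒Classification (i , k) (i' , k') (left , right) with i' F.≤? i | k F.≤? k'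
  ... | yes i'≤i | yes k≤k' with left i'≤i | right k≤k'
  ...   | refl , refl | _ , refl = inj₁ (refl , refl)
  Δ-Vanishes⇒Classification (i , k) (i' , k') (left , right)
      | yes i'≤i | no k≰k' with left i'≤i
  ...   | refl , refl = inj₂ (inj₂ (inj₁ (i , k' , i , refl , refl , F.<⇒≢ k'<i ∘ sym , k'<i , F.≤-refl)))
    where k'<i = ℕ.≰⇒> k≰k'
  Δ-Vanishes⇒Classification (i , k) (i' , k') (left , right)
      | no i'≰i | yes k≤k' with right k≤k'
  ...   | refl , refl = inj₂ (inj₁ (i , k , k , refl , F.<⇒≢ i<k , refl , i<k , F.≤-refl))
    where i<k = ℕ.≰⇒> i'≰i
  Δ-Vanishes⇒Classification (i , k) (i' , k') (left , right)
      | no i'≰i | no k≰k' with i F.≟ k | i' F.≟ k'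
  ... | yes refl | _ =
    inj₂ (inj₂ (inj₁ (i' , k' , i , refl , refl , F.<⇒≢ (F.<-trans k'<i i<i') ∘ sym , k'<i , ℕ.<⇒≤ i<i')))
    where i<i' = ℕ.≰⇒> i'≰i
          k'<i = ℕ.≰⇒> k≰k'
  ... | no i≢k | yes refl =
    inj₂ (inj₁ (i , k , i' , refl , i≢k , refl , ℕ.≰⇒> i'≰i , ℕ.<⇒≤ (ℕ.≰⇒> k≰k')))
  ... | no i≢k | no i'≢k' =
    inj₂ (inj₂ (inj₂ (i , k , i' , k' , refl , refl , i≢k , i'≢k' , ℕ.≰⇒> i'≰i , ℕ.≰⇒> k≰k')))

  Classification⇒Δ-Vanishes : (c c' : Colour n) → Classification c c' → Δ-Vanishes c c'
  Classification⇒Δ-Vanishes _ _ (inj₁ (refl , refl)) =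
    (λ _ → refl , refl) , (λ _ → refl , refl)
  Classification⇒Δ-Vanishes _ _ (inj₂ (inj₁ (i , j , k , refl , _ , refl , i<k , k≤j))) =
    (λ k≤i → contradiction k≤i (ℕ.<⇒≱ i<k)) , (λ j≤k → F.≤-antisym j≤k k≤j , refl)
  Classification⇒Δ-Vanishes _ _ (inj₂ (inj₂ (inj₁ (i , j , k , refl , refl , _ , j<k , k≤i)))) =
    (λ i≤k → refl , F.≤-antisym k≤i i≤k) , (λ k≤j → contradiction k≤j (ℕ.<⇒≱ j<k))
  Classification⇒Δ-Vanishes _ _ (inj₂ (inj₂ (inj₂ (i , j , k , l , refl , refl , _ , _ , i<k , l<j)))) =
    (λ k≤i → contradiction k≤i (ℕ.<⇒≱ i<k)) , (λ j≤l → contradiction j≤l (ℕ.<⇒≱ l<j))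

proposition4p3 : (n : ℕ) → .{{_ : NonZero n}} → (c c' : Colour n) →
    (Δ c c' ≡ + 0) ⇔
    ((c ≡ c' × Free c)
    ⊎ (∃[ i ] ∃[ j ] ∃[ k ] (c ≡ (i , j) × Bound c × c' ≡ (k , k) × i < k × k ≤ j))
    ⊎ (∃[ i ] ∃[ j ] ∃[ k ] (c ≡ (k , k) × c' ≡ (i , j) × Bound c' × j < k × k ≤ i))
    ⊎ (∃[ i ] ∃[ j ] ∃[ k ] ∃[ l ] (c ≡ (i , j) × c' ≡ (k , l) × Bound c × Bound c' × i < k × j > l)))
proposition4p3 n c c' =
  mk⇔ (Δ-Vanishes⇒Classification c c') (Classification⇒Δ-Vanishes c c')
    ⇔-∘ Δ≡0⇔Δ-Vanishes c c'
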